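{- Let $S\subseteq\mathbb{Z}^2$ be an antimatroidal point set, let $x_{\max},y_{\max}$ be the maximum $x$- and $y$-coordinates of points of $S$, and list the points of $\mathcal{B}_{lower}$ in lexicographic order as $B_0,\dots,B_k$. Then $B_0,\dots,B_k$ is an $N_4$-path between $(0,0)$ and $(x_{\max},y_{\max})$, i.e. $B_0=(0,0)$, $B_k=(x_{\max},y_{\max})$, and $B_{i+1}\in N_4(B_i)$ for all $0\le i<k$.
   Context: A point $A=(x_A,y_A)\in\mathbb{Z}^2$ is regarded as a multiset over $\{x,y\}$; $A\subseteq B$ means $x_A\le x_B$ and $y_A\le y_B$. A finite nonempty set $S\subseteq\mathbb{Z}^2$ is an antimatroidal point set if (A1) for every $(x_A,y_A)\in S$ with $(x_A,y_A)\neq(0,0)$, either $(x_A-1,y_A)\in S$ or $(x_A,y_A-1)\in S$; (A2) for all $A,B\in S$ with $A\not\subseteq B$: if $x_A\ge x_B$ and $y_A\ge y_B$ then $(x_B+1,y_B)\in S$ or $(x_B,y_B+1)\in S$; if $x_A\le x_B$ and $y_A\ge y_B$ then $(x_B,y_B+1)\in S$; if $x_A\ge x_B$ and $y_A\le y_B$ then $(x_B+1,y_B)\in S$. $N_4(x,y)=\{(x-1,y),(x,y-1),(x+1,y),(x,y+1)\}$. The lower boundary is $\mathcal{B}_{lower}=\{(x,y)\in S:(x+1,y)\notin S\ \vee\ (x,y-1)\notin S\ \vee\ (x+1,y-1)\notin S\}$. -}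

module Defs where

open import Data.Integer using (ℤ; +_; _+_; _-_; _≤_; _<_)
open import Data.Product using (_×_; _,_; proj₁; proj₂; ∃)
open import Data.Sum using (_⊎_)
open import Data.List using (List; []; _∷_; head; last)
open import Data.List.Membership.Propositional using (_∈_; _∉_)
open import Data.List.Relation.Unary.Linked using (Linked)
open import Data.Maybe using (just)
open import Relation.Nullary using (¬_)
open import Relation.Binary.PropositionalEquality using (_≡_; _≢_)

Point : Set
Point = ℤ × ℤ

xOf : Point → ℤ
xOf = proj₁

yOf : Point → ℤ
yOf = proj₂

origin : Point
origin = (+ 0 , + 0)

-- A finite set of points is represented by a list (duplicates irrelevant);
-- membership is list membership.
PointSet : Set
PointSet = List Point

-- Multiset inclusion A ⊆ B: x_A ≤ x_B and y_A ≤ y_B.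
_⊑_ : Point → Point → Set
A ⊑ B = (xOf A ≤ xOf B) × (yOf A ≤ yOf B)

A1 : PointSet → Set
A1 S = ∀ A → A ∈ S → A ≢ origin →
  ((xOf A - + 1 , yOf A) ∈ S) ⊎ ((xOf A , yOf A - + 1) ∈ S)

A2 : PointSet → Set
A2 S = ∀ A B → A ∈ S → B ∈ S → ¬ (A ⊑ B) →
  ((xOf B ≤ xOf A) → (yOf B ≤ yOf A) →
      ((xOf B + + 1 , yOf B) ∈ S) ⊎ ((xOf B , yOf B + + 1) ∈ S))
  × ((xOf A ≤ xOf B) → (yOf B ≤ yOf A) → (xOf B , yOf B + + 1) ∈ S)
  × ((xOf B ≤ xOf A) → (yOf A ≤ yOf B) → (xOf B + + 1 , yOf B) ∈ S)

record Antimatroidal (S : PointSet) : Set where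
  field
    nonempty : ∃ λ A → A ∈ S
    a1 : A1 S
    a2 : A2 S

InLower : PointSet → Point → Set
InLower S (x , y) = ((x , y) ∈ S) ×
  (((x + + 1 , y) ∉ S) ⊎ ((x , y - + 1) ∉ S) ⊎ ((x + + 1 , y - + 1) ∉ S))

N4 : Point → List Point
N4 (x , y) = (x - + 1 , y) ∷ (x , y - + 1) ∷ (x + + 1 , y) ∷ (x , y + + 1) ∷ []

_<lex_ : Point → Point → Set
(x , y) <lex (x' , y') = (x < x') ⊎ ((x ≡ x') × (y < y'))

IsMaxX : PointSet → ℤ → Set
IsMaxX S m = (∃ λ A → (A ∈ S) × (xOf A ≡ m)) × (∀ A → A ∈ S → xOf A ≤ m)

IsMaxY : PointSet → ℤ → Set
IsMaxY S m = (∃ λ A → (A ∈ S) × (yOf A ≡ m)) × (∀ A → A ∈ S → yOf A ≤ m)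

LexListing : PointSet → List Point → Set
LexListing S L = Linked _<lex_ L × (∀ P → (P ∈ L → InLower S P) × (InLower S P → P ∈ L))

N4Path : Point → Point → List Point → Set
N4Path s t L = (head L ≡ just s) × (last L ≡ just t) × Linked (λ B B' → B' ∈ N4 B) L

-- By A1 every point of S descends through S to the origin, so S contains (0,0) and lies in
-- the first quadrant; by A2 each column of S is an interval that starts no lower than the
-- columns to its left, and (x_max, y_max) ∈ S.  Take a lower boundary point B = (x, y) other
-- than (x_max, y_max).  If (x+1, y) ∈ S, it is the lexicographically next boundary point:
-- column x+1 has nothing below height y, and the points of column x above B are interior.
-- Otherwise A2 forces (x, y+1) ∈ S, which is then the next boundary point.  So consecutive
-- points of the lexicographic listing are N₄-neighbours.
module Submission where

open import Defs
open import Data.Nat using (zero; suc)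
open import Data.Integer using (ℤ; +_; -1ℤ; 1ℤ; _+_; _-_; _≤_; _<_; ∣_∣)
open import Data.Integer.Properties
open import Data.Integer.Tactic.RingSolver using (solve-∀)
open import Data.Product using (_×_; _,_; proj₁; proj₂; ∃)
open import Data.Product.Properties using (≡-dec)
open import Data.Product.Relation.Binary.Lex.Strict using (×-transitive; ×-irreflexive)
open import Data.Product.Relation.Binary.Pointwise.NonDependent using (≡⇒≡×≡)
open import Data.Sum using (_⊎_; inj₁; inj₂)
open import Data.Unit using (⊤; tt)
open import Data.List using (List; []; _∷_; head; last; filter)
open import Data.List.Membership.Propositional using (_∈_; _∉_)
open import Data.List.Membership.Propositional.Properties using (∈-filter⁺; ∈-filter⁻)
open import Data.List.Relation.Unary.All using (lookup; tabulate)
open import Data.List.Relation.Unary.AllPairs as AllPairs using ()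
open import Data.List.Relation.Unary.Any using (here; there)
open import Data.List.Relation.Unary.Linked using (Linked; []; [-]; _∷_)
open import Data.List.Relation.Unary.Linked.Properties using (Linked⇒AllPairs)
open import Data.Maybe using (just)
open import Function using (_∘_; id)
open import Level using (Level)
open import Relation.Binary using (Rel; Transitive; Irreflexive; DecidableEquality)
open import Relation.Binary.PropositionalEquality
open import Relation.Nullary using (¬_; yes; no; contradiction)
open import Relation.Nullary.Decidable using (_×-dec_)
open import Relation.Unary using (Pred; Decidable)

private
  variable
    a ℓ p r : Level

i<i+1 : ∀ i → i < i + + 1
i<i+1 i = suc[i]≤j⇒i<j (≤-reflexive (+-comm 1ℤ i))

i-1<i : ∀ i → i - + 1 < i
i-1<i i = i≤pred[j]⇒i<j (≤-reflexive (+-comm i -1ℤ))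

i+1≤j⇒i<j : ∀ {i j} → i + + 1 ≤ j → i < j
i+1≤j⇒i<j {i} i+1≤j = suc[i]≤j⇒i<j (≤-trans (≤-reflexive (+-comm 1ℤ i)) i+1≤j)

i<j⇒i≤j-1 : ∀ {i j} → i < j → i ≤ j - + 1
i<j⇒i≤j-1 {j = j} i<j = ≤-trans (i<j⇒i≤pred[j] i<j) (≤-reflexive (+-comm -1ℤ j))

i+1-1≡i : ∀ i → (i + + 1) - + 1 ≡ i
i+1-1≡i i = trans (+-assoc i (+ 1) -1ℤ) (+-identityʳ i)

i<j+1⇒i≤j : ∀ {i j} → i < j + + 1 → i ≤ j
i<j+1⇒i≤j {j = j} i<j+1 = ≤-trans (i<j⇒i≤j-1 i<j+1) (≤-reflexive (i+1-1≡i j))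

i+[j-i]≡j : ∀ i j → i + (j - i) ≡ j
i+[j-i]≡j = solve-∀

ℤ-interval-induction : (P : ℤ → Set p) {a b : ℤ} → P a →
  (∀ {c} → c < b → P c → P (c + + 1)) →
  ∀ {c} → a ≤ c → c ≤ b → P c
ℤ-interval-induction P {a} {b} Pa step {c} a≤c c≤b =
  subst P a+∣c-a∣≡c (from ∣ c - a ∣ (≤-trans (≤-reflexive a+∣c-a∣≡c) c≤b))
  where
  a+∣c-a∣≡c : a + + ∣ c - a ∣ ≡ c
  a+∣c-a∣≡c = trans (cong (_+_ a) (0≤i⇒+∣i∣≡i (i≤j⇒0≤j-i a≤c))) (i+[j-i]≡j a c)
  shift : ∀ n → (a + + n) + + 1 ≡ a + + suc n
  shift n = trans (+-assoc a (+ n) (+ 1)) (cong (_+_ a) (+-comm (+ n) (+ 1)))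
  from : ∀ n → a + + n ≤ b → P (a + + n)
  from zero    _    = subst P (sym (+-identityʳ a)) Pa
  from (suc n) a+n+1≤b = subst P (shift n) (step a+n<b (from n (<⇒≤ a+n<b)))
    where
    a+n<b : a + + n < b
    a+n<b = i+1≤j⇒i<j (≤-trans (≤-reflexive (shift n)) a+n+1≤b)

module _ {A : Set a} (f : A → ℤ) {Q : Pred A p} (Q? : Decidable Q) where
  open import Data.List.Extrema ≤-totalOrder using (argmin; argmin-all; f[argmin]≤f[xs])

  least-exists : ∀ {xs z} → z ∈ xs → Q z →
    ∃ λ m → m ∈ xs × Q m × (∀ w → w ∈ xs → Q w → f m ≤ f w)
  least-exists {xs} {z} z∈xs Qz = m , proj₁ m∈xs×Qm , proj₂ m∈xs×Qm , least
    where
    ys : List A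
    ys = filter Q? xs
    m : A
    m = argmin f z ys
    m∈xs×Qm : m ∈ xs × Q m
    m∈xs×Qm = argmin-all f (z∈xs , Qz) (tabulate (∈-filter⁻ Q?))
    least : ∀ w → w ∈ xs → Q w → f m ≤ f w
    least w w∈xs Qw = lookup (f[argmin]≤f[xs] z ys) (∈-filter⁺ Q? w∈xs Qw)

<lex-trans : Transitive _<lex_
<lex-trans =
  ×-transitive {_≈₁_ = _≡_} {_<₁_ = _<_} {_<₂_ = _<_} isEquivalence (resp₂ _<_) <-trans <-trans

<lex-irrefl : Irreflexive _≡_ _<lex_
<lex-irrefl P≡Q =
  ×-irreflexive {_≈₁_ = _≡_} {_<₁_ = _<_} {_≈₂_ = _≡_} {_<₂_ = _<_} <-irrefl <-irrefl (≡⇒≡×≡ P≡Q)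

<lex-between-right : ∀ {x y a b} → (x , y) <lex (a , b) → (a , b) <lex (x + + 1 , y) →
  (a ≡ x × y < b) ⊎ (a ≡ x + + 1 × b < y)
<lex-between-right (inj₁ x<a) (inj₁ a<x+1)         = contradiction (i<j+1⇒i≤j a<x+1) (<⇒≱ x<a)
<lex-between-right (inj₁ _)   (inj₂ a≡x+1,b<y)     = inj₂ a≡x+1,b<y
<lex-between-right (inj₂ (refl , y<b)) _           = inj₁ (refl , y<b)

<lex-nothing-between-up : ∀ {x y a b} → (x , y) <lex (a , b) → ¬ (a , b) <lex (x , y + + 1)
<lex-nothing-between-up (inj₁ x<a)          (inj₁ a<x)          = <-asym x<a a<x
<lex-nothing-between-up (inj₁ x<a)          (inj₂ (refl , _))   = <-irrefl refl x<a
<lex-nothing-between-up (inj₂ (refl , _))   (inj₁ x<x)          = <-irrefl refl x<x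
<lex-nothing-between-up (inj₂ (refl , y<b)) (inj₂ (_ , b<y+1)) = <⇒≱ y<b (i<j+1⇒i≤j b<y+1)

SortedListing : {A : Set a} → Rel A ℓ → Pred A p → List A → Set _
SortedListing _<_ P L = Linked _<_ L × (∀ x → (x ∈ L → P x) × (P x → x ∈ L))

Covers : {A : Set a} → Rel A ℓ → Pred A p → A → A → Set _
Covers _<_ P x y = P y × x < y × (∀ z → P z → x < z → ¬ z < y)

module SortedListings {A : Set a} {_<_ : Rel A ℓ}
  (<-trans : Transitive _<_) (<-irrefl : Irreflexive _≡_ _<_) {P : Pred A p} where

  head<tail : ∀ {x xs z} → Linked _<_ (x ∷ xs) → z ∈ xs → x < z
  head<tail sorted = lookup (AllPairs.head (Linked⇒AllPairs <-trans sorted))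

  ∈-tail : ∀ {x xs z} → z ∈ x ∷ xs → x < z → z ∈ xs
  ∈-tail (here refl)  x<x = contradiction x<x (<-irrefl refl)
  ∈-tail (there z∈xs) _   = z∈xs

  head-of-sorted-listing : ∀ {L m} → SortedListing _<_ P L → P m → (∀ z → P z → ¬ z < m) →
    head L ≡ just m
  head-of-sorted-listing {[]}    (_ , listed) Pm _ = contradiction (proj₂ (listed _) Pm) λ ()
  head-of-sorted-listing {x ∷ _} (sorted , listed) Pm least with proj₂ (listed _) Pm
  ... | here refl    = refl
  ... | there m∈tail =
    contradiction (head<tail sorted m∈tail) (least x (proj₁ (listed x) (here refl)))

  last-of-sorted : ∀ {m x} xs → Linked _<_ (x ∷ xs) → m ∈ x ∷ xs → (∀ z → z ∈ xs → ¬ m < z) →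
    last (x ∷ xs) ≡ just m
  last-of-sorted []       _            (here refl) _        = refl
  last-of-sorted (y ∷ _)  (x<y ∷ _)    (here refl) greatest = contradiction x<y (greatest y (here refl))
  last-of-sorted (_ ∷ ys) (_ ∷ sorted) (there m∈)  greatest =
    last-of-sorted ys sorted m∈ (λ z → greatest z ∘ there)

  last-of-sorted-listing : ∀ {L m} → SortedListing _<_ P L → P m → (∀ z → P z → ¬ m < z) →
    last L ≡ just m
  last-of-sorted-listing {[]}     (_ , listed) Pm _ = contradiction (proj₂ (listed _) Pm) λ ()
  last-of-sorted-listing {_ ∷ xs} (sorted , listed) Pm greatest =
    last-of-sorted xs sorted (proj₂ (listed _) Pm) (λ z → greatest z ∘ proj₁ (listed z) ∘ there)

  -- The cover of x is listed after x, and by minimality nothing is listed between them.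
  sorted-listing-linked : ∀ {R : Rel A r} {L} → SortedListing _<_ P L →
    (∀ {x y} → P x → P y → x < y → ∃ λ z → Covers _<_ P x z × R x z) →
    Linked R L
  sorted-listing-linked {L = []}    _                 _     = []
  sorted-listing-linked {R = R} {L = _ ∷ _} (sorted , listed) cover =
    go sorted (proj₁ (listed _)) (λ z Pz x<z → ∈-tail (proj₂ (listed z) Pz) x<z)
    where
    go : ∀ {x xs} → Linked _<_ (x ∷ xs) → (∀ {z} → z ∈ x ∷ xs → P z) →
      (∀ z → P z → x < z → z ∈ xs) → Linked R (x ∷ xs)
    go [-] _ _ = [-]
    go (x<y ∷ sorted) inP above with cover (inP (here refl)) (inP (there (here refl))) x<y
    ... | z , (Pz , x<z , least) , xRz with above z Pz x<z
    ...   | here refl   = xRz ∷ go sorted (inP ∘ there)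
                                  (λ w Pw y<w → ∈-tail (above w Pw (<-trans x<y y<w)) y<w)
    ...   | there z∈ys =
      contradiction (head<tail sorted z∈ys) (least _ (inP (there (here refl))) x<y)

weight : Point → ℤ
weight (x , y) = x + y

_≟ₚ_ : DecidableEquality Point
_≟ₚ_ = ≡-dec _≟_ _≟_

open import Data.List.Membership.DecPropositional _≟ₚ_ using (_∈?_)

module AntimatroidalPointSet {S : PointSet} (am : Antimatroidal S) where
  open Antimatroidal am

  step-up : ∀ {a b A} → (a , b) ∈ S → A ∈ S → xOf A ≤ a → b < yOf A → (a , b + + 1) ∈ S
  step-up {A = A} B∈S A∈S xA≤a b<yA =
    proj₁ (proj₂ (a2 A _ A∈S B∈S (λ A⊑B → <⇒≱ b<yA (proj₂ A⊑B)))) xA≤a (<⇒≤ b<yA)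

  step-right : ∀ {a b A} → (a , b) ∈ S → A ∈ S → a < xOf A → yOf A ≤ b → (a + + 1 , b) ∈ S
  step-right {A = A} B∈S A∈S a<xA yA≤b =
    proj₂ (proj₂ (a2 A _ A∈S B∈S (λ A⊑B → <⇒≱ a<xA (proj₁ A⊑B)))) (<⇒≤ a<xA) yA≤b

  step-diagonal : ∀ {a b A} → (a , b) ∈ S → A ∈ S → a < xOf A → b < yOf A →
    (a + + 1 , b) ∈ S ⊎ (a , b + + 1) ∈ S
  step-diagonal {A = A} B∈S A∈S a<xA b<yA =
    proj₁ (a2 A _ A∈S B∈S (λ A⊑B → <⇒≱ a<xA (proj₁ A⊑B))) (<⇒≤ a<xA) (<⇒≤ b<yA)

  column-fill : ∀ {a b c A} → (a , b) ∈ S → A ∈ S → xOf A ≤ a → b ≤ c → c ≤ yOf A → (a , c) ∈ S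
  column-fill {a} B∈S A∈S xA≤a =
    ℤ-interval-induction (λ c → (a , c) ∈ S) B∈S (λ c<yA c∈S → step-up c∈S A∈S xA≤a c<yA)

  row-fill : ∀ {a b c A} → (a , b) ∈ S → A ∈ S → yOf A ≤ b → a ≤ c → c ≤ xOf A → (c , b) ∈ S
  row-fill {b = b} B∈S A∈S yA≤b =
    ℤ-interval-induction (λ c → (c , b) ∈ S) B∈S (λ c<xA c∈S → step-right c∈S A∈S c<xA yA≤b)

  least-weight≡origin : ∀ {Q : Pred Point p} {x y} → (x , y) ∈ S →
    (∀ A → A ∈ S → Q A → weight (x , y) ≤ weight A) →
    Q (x - + 1 , y) → Q (x , y - + 1) → (x , y) ≡ origin
  least-weight≡origin {x = x} {y} P∈S least Q-left Q-down with (x , y) ≟ₚ origin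
  ... | yes P≡origin = P≡origin
  ... | no  P≢origin with a1 _ P∈S P≢origin
  ...   | inj₁ left∈S = contradiction (least _ left∈S Q-left) (<⇒≱ (+-monoˡ-< y (i-1<i x)))
  ...   | inj₂ down∈S = contradiction (least _ down∈S Q-down) (<⇒≱ (+-monoʳ-< x (i-1<i y)))

  descent : (Q : Pred Point p) → Decidable Q →
    (∀ {x y} → Q (x , y) → Q (x - + 1 , y)) → (∀ {x y} → Q (x , y) → Q (x , y - + 1)) →
    ∀ {A} → A ∈ S → Q A → origin ∈ S × Q origin
  descent Q Q? Q-left Q-down A∈S QA with least-exists weight Q? A∈S QA
  ... | _ , P∈S , QP , least with least-weight≡origin P∈S least (Q-left QP) (Q-down QP)
  ...   | refl = P∈S , QP

  origin∈S : origin ∈ S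
  origin∈S = proj₁ (descent (λ _ → ⊤) (λ _ → yes tt) id id (proj₂ nonempty) tt)

  0≤xOf : ∀ {A} → A ∈ S → + 0 ≤ xOf A
  0≤xOf {A} A∈S with + 0 ≤? xOf A
  ... | yes 0≤x = 0≤x
  ... | no  0≰x = contradiction (proj₂ (descent (λ P → xOf P < + 0) (λ P → xOf P <? + 0)
                    (<-trans (i-1<i _)) id A∈S (≰⇒> 0≰x))) (<-irrefl refl)

  0≤yOf : ∀ {A} → A ∈ S → + 0 ≤ yOf A
  0≤yOf {A} A∈S with + 0 ≤? yOf A
  ... | yes 0≤y = 0≤y
  ... | no  0≰y = contradiction (proj₂ (descent (λ P → yOf P < + 0) (λ P → yOf P <? + 0)
                    id (<-trans (i-1<i _)) A∈S (≰⇒> 0≰y))) (<-irrefl refl)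

  -- Among the points of S in columns ≥ a and at heights ≤ d, one of least weight lies in column a.
  column-below : ∀ {a c d} → + 0 ≤ a → (c , d) ∈ S → a ≤ c → ∃ λ e → e ≤ d × (a , e) ∈ S
  column-below {a} {c} {d} 0≤a C∈S a≤c
    with least-exists weight (λ P → (a ≤? xOf P) ×-dec (yOf P ≤? d)) C∈S (a≤c , ≤-refl)
  ... | (x , y) , P∈S , (a≤x , y≤d) , least with x ≟ a
  ...   | yes refl = y , y≤d , P∈S
  ...   | no  x≢a  = contradiction (subst (λ P → a < xOf P) P≡origin a<x) (≤⇒≯ 0≤a)
    where
    a<x : a < x
    a<x = ≤∧≢⇒< a≤x (x≢a ∘ sym)
    P≡origin : (x , y) ≡ origin
    P≡origin = least-weight≡origin P∈S least
      (i<j⇒i≤j-1 a<x , y≤d) (a≤x , ≤-trans (<⇒≤ (i-1<i y)) y≤d)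

  origin-lower : InLower S origin
  origin-lower = origin∈S , inj₂ (inj₁ (λ below∈S → <⇒≱ (i-1<i (+ 0)) (0≤yOf below∈S)))

  origin-least : ∀ P → InLower S P → ¬ P <lex origin
  origin-least _ (P∈S , _) (inj₁ x<0)       = <⇒≱ x<0 (0≤xOf P∈S)
  origin-least _ (P∈S , _) (inj₂ (_ , y<0)) = <⇒≱ y<0 (0≤yOf P∈S)

  nothing-below-right-of-lower : ∀ {x y b} → InLower S (x , y) → (x + + 1 , y) ∈ S →
    (x + + 1 , b) ∈ S → ¬ b < y
  nothing-below-right-of-lower (_ , inj₁ right∉S) right∈S _ _ = right∉S right∈S
  nothing-below-right-of-lower {y = y} (_ , inj₂ (inj₂ diag∉S)) right∈S low∈S b<y =
    diag∉S (column-fill low∈S right∈S ≤-refl (i<j⇒i≤j-1 b<y) (<⇒≤ (i-1<i y)))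
  nothing-below-right-of-lower {x} {y} (B∈S , inj₂ (inj₁ down∉S)) _ low∈S b<y
    with column-below (0≤xOf B∈S) low∈S (<⇒≤ (i<i+1 x))
  ... | e , e≤b , e∈S =
    down∉S (column-fill e∈S B∈S ≤-refl (≤-trans e≤b (i<j⇒i≤j-1 b<y)) (<⇒≤ (i-1<i y)))

  above-right-neighbour-not-lower : ∀ {x y b} → (x , y) ∈ S → (x + + 1 , y) ∈ S → y < b →
    (x , b) ∈ S → ¬ InLower S (x , b)
  above-right-neighbour-not-lower {x} B∈S right∈S y<b Q∈S (_ , inj₁ right∉S) =
    right∉S (column-fill right∈S Q∈S (<⇒≤ (i<i+1 x)) (<⇒≤ y<b) ≤-refl)
  above-right-neighbour-not-lower {b = b} B∈S right∈S y<b Q∈S (_ , inj₂ (inj₁ down∉S)) =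
    down∉S (column-fill B∈S Q∈S ≤-refl (i<j⇒i≤j-1 y<b) (<⇒≤ (i-1<i b)))
  above-right-neighbour-not-lower {x} {b = b} B∈S right∈S y<b Q∈S (_ , inj₂ (inj₂ diag∉S)) =
    diag∉S (column-fill right∈S Q∈S (<⇒≤ (i<i+1 x)) (i<j⇒i≤j-1 y<b) (<⇒≤ (i-1<i b)))

  right-neighbour-covers : ∀ {x y} → InLower S (x , y) → (x + + 1 , y) ∈ S →
    Covers _<lex_ (InLower S) (x , y) (x + + 1 , y)
  right-neighbour-covers {x} {y} B-lower right∈S =
    (right∈S , inj₂ (inj₁ nothing-below)) , inj₁ (i<i+1 x) , between
    where
    nothing-below : (x + + 1 , y - + 1) ∉ S
    nothing-below down∈S = nothing-below-right-of-lower B-lower right∈S down∈S (i-1<i y)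
    between : ∀ Q → InLower S Q → (x , y) <lex Q → ¬ Q <lex (x + + 1 , y)
    between _ Q-lower B<Q Q<right with <lex-between-right B<Q Q<right
    ... | inj₁ (refl , y<b) =
      above-right-neighbour-not-lower (proj₁ B-lower) right∈S y<b (proj₁ Q-lower) Q-lower
    ... | inj₂ (refl , b<y) = nothing-below-right-of-lower B-lower right∈S (proj₁ Q-lower) b<y

  upper-neighbour-covers : ∀ {x y} → (x + + 1 , y) ∉ S → (x , y + + 1) ∈ S →
    Covers _<lex_ (InLower S) (x , y) (x , y + + 1)
  upper-neighbour-covers {x} {y} right∉S up∈S =
    (up∈S , inj₂ (inj₂ (subst (λ b → (x + + 1 , b) ∉ S) (sym (i+1-1≡i y)) right∉S))) ,
    inj₂ (refl , i<i+1 y) ,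
    λ _ _ → <lex-nothing-between-up

  module Top {X Y : ℤ} (max-x : IsMaxX S X) (max-y : IsMaxY S Y) where

    top∈S : (X , Y) ∈ S
    top∈S with proj₁ max-x | proj₁ max-y
    ... | _ , A∈S , refl | _ , B∈S , refl =
      row-fill B∈S A∈S (proj₂ max-y _ A∈S) (proj₂ max-x _ B∈S) ≤-refl

    top-lower : InLower S (X , Y)
    top-lower = top∈S , inj₁ (λ right∈S → <⇒≱ (i<i+1 X) (proj₂ max-x _ right∈S))

    top-greatest : ∀ P → InLower S P → ¬ (X , Y) <lex P
    top-greatest _ (P∈S , _) (inj₁ X<x)       = <⇒≱ X<x (proj₂ max-x _ P∈S)
    top-greatest _ (P∈S , _) (inj₂ (_ , Y<y)) = <⇒≱ Y<y (proj₂ max-y _ P∈S)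

    below-lower≢top : ∀ {B C} → InLower S C → B <lex C → B ≢ (X , Y)
    below-lower≢top C-lower top<C refl = top-greatest _ C-lower top<C

    step-left-of-top : ∀ {x y} → (x , y) ∈ S → x < X → (x + + 1 , y) ∈ S ⊎ (x , y + + 1) ∈ S
    step-left-of-top {y = y} P∈S x<X with proj₁ max-x
    ... | A , A∈S , refl with yOf A ≤? y
    ...   | yes yA≤y = inj₁ (step-right P∈S A∈S x<X yA≤y)
    ...   | no  yA≰y = step-diagonal P∈S A∈S x<X (≰⇒> yA≰y)

    step-below-top : ∀ {y} → (X , y) ∈ S → y < Y → (X , y + + 1) ∈ S
    step-below-top P∈S y<Y with proj₁ max-y
    ... | B , B∈S , refl = step-up P∈S B∈S (proj₂ max-x _ B∈S) y<Y

    step-towards-top : ∀ {x y} → (x , y) ∈ S → (x , y) ≢ (X , Y) →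
      (x + + 1 , y) ∈ S ⊎ (x , y + + 1) ∈ S
    step-towards-top {x} {y} P∈S P≢top with x ≟ X | y ≟ Y
    ... | no  x≢X | _        = step-left-of-top P∈S (≤∧≢⇒< (proj₂ max-x _ P∈S) x≢X)
    ... | yes refl | no  y≢Y = inj₂ (step-below-top P∈S (≤∧≢⇒< (proj₂ max-y _ P∈S) y≢Y))
    ... | yes refl | yes refl = contradiction refl P≢top

    lower-covered-by-neighbour : ∀ {B C} → InLower S B → InLower S C → B <lex C →
      ∃ λ N → Covers _<lex_ (InLower S) B N × N ∈ N4 B
    lower-covered-by-neighbour {x , y} B-lower C-lower B<C with (x + + 1 , y) ∈? S
    ... | yes right∈S = _ , right-neighbour-covers B-lower right∈S , there (there (here refl))
    ... | no  right∉S with step-towards-top (proj₁ B-lower) (below-lower≢top C-lower B<C)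
    ...   | inj₁ right∈S = contradiction right∈S right∉S
    ...   | inj₂ up∈S    =
      _ , upper-neighbour-covers right∉S up∈S , there (there (there (here refl)))

lemma4 : (S : PointSet) → Antimatroidal S →
    (xmax ymax : ℤ) → IsMaxX S xmax → IsMaxY S ymax →
    (L : List Point) → LexListing S L →
    N4Path origin (xmax , ymax) L
lemma4 S am xmax ymax max-x max-y L listing =
  head-of-sorted-listing listing origin-lower origin-least ,
  last-of-sorted-listing listing top-lower top-greatest ,
  sorted-listing-linked listing lower-covered-by-neighbour
  where
  open AntimatroidalPointSet am
  open Top max-x max-y
  open SortedListings <lex-trans <lex-irrefl {P = InLower S}
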